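{- Let $L$ be a Boolean algebra with its natural order, and let $\hat L_{\bowtie}$ be the change action with base $L$, change set $L\bowtie L=\{(p,q)\in L\times L\mid p\wedge q=\bot\}$, monoid operation $(p,q)\bowtie(r,s)=((p\wedge\neg s)\vee r,(q\wedge\neg r)\vee s)$ with identity $(\bot,\bot)$, and action $a\oplus_{\bowtie}(p,q)=(a\vee p)\wedge\neg q$. Equip $L\bowtie L$ with the order $(p,q)\le_{\bowtie}(r,s)$ iff $p\le r$ and $q\ge s$. Then $\hat L_{\bowtie}$ is an ordered change action.
   Context: A change action $\hat A=(A,\Delta A,\oplus,+,0)$ consists of a set $A$, a monoid $(\Delta A,+,0)$ and a map $\oplus:A\times\Delta A\to A$ with $a\oplus 0=a$ and $a\oplus(\delta_1+\delta_2)=(a\oplus\delta_1)\oplus\delta_2$. It is ordered if $A$ and $\Delta A$ are posets and $\oplus:A\times\Delta A\to A$ and $+:\Delta A\times\Delta A\to\Delta A$ are monotone. -}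

module Defs where

open import Level using (Level; _⊔_)
open import Data.Product using (_×_; _,_; proj₁; proj₂)
open import Relation.Binary using (Rel; IsPartialOrder; IsEquivalence)
open import Relation.Unary using (Pred; _∈_)
open import Algebra.Core using (Op₂)
open import Algebra.Lattice.Bundles using (BooleanAlgebra)

-- The change set ΔA is given as a subset (predicate) of an ambient type D,
-- so that closure of the monoid operation is part of the claim.
record IsOrderedChangeAction
  {a ℓa ℓ≤a d p ℓd ℓ≤d : Level}
  (A : Set a) (_≈A_ : Rel A ℓa) (_≤A_ : Rel A ℓ≤a)
  (D : Set d) (ΔA : Pred D p) (_≈D_ : Rel D ℓd) (_≤D_ : Rel D ℓ≤d)
  (_+_ : Op₂ D) (0# : D) (_⊕_ : A → D → A)
  : Set (a ⊔ ℓa ⊔ ℓ≤a ⊔ d ⊔ p ⊔ ℓd ⊔ ℓ≤d) where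
  field
    ≈D-isEquivalence : IsEquivalence _≈D_
    0-closed   : 0# ∈ ΔA
    +-closed   : ∀ {x y} → x ∈ ΔA → y ∈ ΔA → (x + y) ∈ ΔA
    +-cong     : ∀ {x x′ y y′} → x ∈ ΔA → x′ ∈ ΔA → y ∈ ΔA → y′ ∈ ΔA →
                 x ≈D x′ → y ≈D y′ → (x + y) ≈D (x′ + y′)
    +-assoc    : ∀ {x y z} → x ∈ ΔA → y ∈ ΔA → z ∈ ΔA →
                 ((x + y) + z) ≈D (x + (y + z))
    +-identityˡ : ∀ {x} → x ∈ ΔA → (0# + x) ≈D x
    +-identityʳ : ∀ {x} → x ∈ ΔA → (x + 0#) ≈D x
    ≈A-isEquivalence : IsEquivalence _≈A_
    ⊕-cong     : ∀ {a a′ δ δ′} → δ ∈ ΔA → δ′ ∈ ΔA →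
                 a ≈A a′ → δ ≈D δ′ → (a ⊕ δ) ≈A (a′ ⊕ δ′)
    ⊕-identity : ∀ a → (a ⊕ 0#) ≈A a
    ⊕-+        : ∀ a {δ₁ δ₂} → δ₁ ∈ ΔA → δ₂ ∈ ΔA →
                 (a ⊕ (δ₁ + δ₂)) ≈A ((a ⊕ δ₁) ⊕ δ₂)
    A-isPartialOrder : IsPartialOrder _≈A_ _≤A_
    ≤D-refl    : ∀ {x y} → x ∈ ΔA → y ∈ ΔA → x ≈D y → x ≤D y
    ≤D-trans   : ∀ {x y z} → x ∈ ΔA → y ∈ ΔA → z ∈ ΔA →
                 x ≤D y → y ≤D z → x ≤D z
    ≤D-antisym : ∀ {x y} → x ∈ ΔA → y ∈ ΔA → x ≤D y → y ≤D x → x ≈D y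
    ⊕-mono     : ∀ {a a′ δ δ′} → δ ∈ ΔA → δ′ ∈ ΔA →
                 a ≤A a′ → δ ≤D δ′ → (a ⊕ δ) ≤A (a′ ⊕ δ′)
    +-mono     : ∀ {x x′ y y′} → x ∈ ΔA → x′ ∈ ΔA → y ∈ ΔA → y′ ∈ ΔA →
                 x ≤D x′ → y ≤D y′ → (x + y) ≤D (x′ + y′)

module BowtieChange {c ℓ : Level} (L : BooleanAlgebra c ℓ) where
  open BooleanAlgebra L

  _≤L_ : Rel Carrier ℓ
  x ≤L y = x ≈ (x ∧ y)

  Pair : Set c
  Pair = Carrier × Carrier

  Disjoint : Pred Pair ℓ
  Disjoint (p , q) = (p ∧ q) ≈ ⊥

  _≈⋈_ : Rel Pair ℓ
  (p , q) ≈⋈ (r , s) = (p ≈ r) × (q ≈ s)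

  _≤⋈_ : Rel Pair ℓ
  (p , q) ≤⋈ (r , s) = (p ≤L r) × (s ≤L q)

  _⋈_ : Op₂ Pair
  (p , q) ⋈ (r , s) = ((p ∧ ¬ s) ∨ r) , ((q ∧ ¬ r) ∨ s)

  ε⋈ : Pair
  ε⋈ = ⊥ , ⊥

  _⊕⋈_ : Carrier → Pair → Carrier
  a ⊕⋈ (p , q) = (a ∨ p) ∧ ¬ q

  IsOrderedChangeAction⋈ : Set (c ⊔ ℓ)
  IsOrderedChangeAction⋈ =
    IsOrderedChangeAction Carrier _≈_ _≤L_ Pair Disjoint _≈⋈_ _≤⋈_ _⋈_ ε⋈ _⊕⋈_

-- A change (p , q) ∈ L ⋈ L adds p and deletes q. Write patch x d a = (x ∧ ¬ d) ∨ a
-- for "delete d, then add a". The product ⋈ is exactly composition of patches: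
-- patching by (p , q) and then by (r , s) is the single patch that deletes
-- (q ∧ ¬ r) ∨ s and adds (p ∧ ¬ s) ∨ r. This one identity gives associativity of ⋈
-- (componentwise) and the action law, because for disjoint p and q the action
-- (x ∨ p) ∧ ¬ q is the patch deleting q and adding p. Monotonicity holds since ∧
-- and ∨ are monotone, ¬ is antitone, and the order on L ⋈ L reverses deletions.

module Submission where

open import Defs
open import Level using (Level)
open import Algebra.Bundles using (CommutativeSemiring)
open import Algebra.Lattice.Bundles using (BooleanAlgebra)
open import Data.Product using (_,_)
open import Data.Product.Relation.Binary.Pointwise.NonDependent
  using (×-isEquivalence; ×-isPartialOrder)
open import Relation.Binary using (IsPartialOrder)
open import Relation.Binary.Lattice using (Lattice)
import Algebra.Lattice.Properties.BooleanAlgebra as BooleanAlgebraProperties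
import Algebra.Properties.CommutativeSemigroup as CommutativeSemigroupProperties
import Relation.Binary.Lattice.Properties.JoinSemilattice as JoinSemilatticeProperties
import Relation.Binary.Lattice.Properties.MeetSemilattice as MeetSemilatticeProperties
import Relation.Binary.Properties.Poset as PosetProperties
import Relation.Binary.Reasoning.Setoid as SetoidReasoning

module _ {c ℓ : Level} (L : BooleanAlgebra c ℓ) where
  open BooleanAlgebra L
  open BooleanAlgebraProperties L
  open BowtieChange L
  open SetoidReasoning setoid

  private
    module ∧ = CommutativeSemigroupProperties
      (CommutativeSemiring.*-commutativeSemigroup ∨-∧-commutativeSemiring)
    module ∨ = CommutativeSemigroupProperties
      (CommutativeSemiring.+-commutativeSemigroup ∨-∧-commutativeSemiring)
    module ⋈ = IsPartialOrder
      (×-isPartialOrder (Lattice.isPartialOrder ∨-∧-orderTheoreticLattice)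
                        (PosetProperties.≥-isPartialOrder poset))
    open JoinSemilatticeProperties (Lattice.joinSemilattice ∨-∧-orderTheoreticLattice)
      using (∨-monotonic; x≤y⇒x∨y≈y)
    open MeetSemilatticeProperties (Lattice.meetSemilattice ∨-∧-orderTheoreticLattice)
      using (∧-monotonic)

  ¬-antitone : ∀ {x y} → x ≤L y → (¬ y) ≤L (¬ x)
  ¬-antitone {x} {y} x≤y = sym (begin
    ¬ y ∧ ¬ x  ≈⟨ deMorgan₂ y x ⟨
    ¬ (y ∨ x)  ≈⟨ ¬-cong (∨-comm y x) ⟩
    ¬ (x ∨ y)  ≈⟨ ¬-cong (x≤y⇒x∨y≈y x≤y) ⟩
    ¬ y        ∎)

  ¬-∧¬ : ∀ x y → ¬ (x ∧ ¬ y) ≈ ¬ x ∨ y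
  ¬-∧¬ x y = trans (deMorgan₁ x (¬ y)) (∨-congˡ (¬-involutive y))

  x∧y≈⊥⇒x∧¬y≈x : ∀ {x y} → x ∧ y ≈ ⊥ → x ∧ ¬ y ≈ x
  x∧y≈⊥⇒x∧¬y≈x {x} {y} x∧y≈⊥ = begin
    x ∧ ¬ y              ≈⟨ ∨-identityˡ (x ∧ ¬ y) ⟨
    ⊥ ∨ (x ∧ ¬ y)        ≈⟨ ∨-congʳ x∧y≈⊥ ⟨
    (x ∧ y) ∨ (x ∧ ¬ y)  ≈⟨ ∧-distribˡ-∨ x y (¬ y) ⟨
    x ∧ (y ∨ ¬ y)        ≈⟨ ∧-congˡ (∨-complementʳ y) ⟩
    x ∧ ⊤                ≈⟨ ∧-identityʳ x ⟩
    x                    ∎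

  patch : Carrier → Carrier → Carrier → Carrier
  patch x d a = (x ∧ ¬ d) ∨ a

  patch-cong : ∀ {x x′ d d′ a a′} → x ≈ x′ → d ≈ d′ → a ≈ a′ →
               patch x d a ≈ patch x′ d′ a′
  patch-cong x≈x′ d≈d′ a≈a′ = ∨-cong (∧-cong x≈x′ (¬-cong d≈d′)) a≈a′

  patch-mono : ∀ {x x′ d d′ a a′} → x ≤L x′ → d′ ≤L d → a ≤L a′ →
               patch x d a ≤L patch x′ d′ a′
  patch-mono x≤x′ d′≤d a≤a′ =
    ∨-monotonic (∧-monotonic x≤x′ (¬-antitone d′≤d)) a≤a′

  ⊥-patch : ∀ d a → patch ⊥ d a ≈ a
  ⊥-patch d a = trans (∨-congʳ (∧-zeroˡ (¬ d))) (∨-identityˡ a)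

  patch-⊥-⊥ : ∀ x → patch x ⊥ ⊥ ≈ x
  patch-⊥-⊥ x = begin
    (x ∧ ¬ ⊥) ∨ ⊥  ≈⟨ ∨-identityʳ (x ∧ ¬ ⊥) ⟩
    x ∧ ¬ ⊥        ≈⟨ ∧-congˡ ¬⊥≈⊤ ⟩
    x ∧ ⊤          ≈⟨ ∧-identityʳ x ⟩
    x              ∎

  patch-patch : ∀ x d a d′ a′ →
    patch (patch x d a) d′ a′ ≈ patch x (patch d a′ d′) (patch a d′ a′)
  patch-patch x d a d′ a′ = sym (begin
    (x ∧ ¬ ((d ∧ ¬ a′) ∨ d′)) ∨ (A ∨ a′)
      ≈⟨ ∨-congʳ (∧-congˡ (trans (deMorgan₂ (d ∧ ¬ a′) d′) (∧-congʳ (¬-∧¬ d a′)))) ⟩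
    (x ∧ ((¬ d ∨ a′) ∧ ¬ d′)) ∨ (A ∨ a′)
      ≈⟨ ∨-congʳ (∧-congˡ (∧-distribʳ-∨ (¬ d′) (¬ d) a′)) ⟩
    (x ∧ ((¬ d ∧ ¬ d′) ∨ (a′ ∧ ¬ d′))) ∨ (A ∨ a′)
      ≈⟨ ∨-congʳ (∧-distribˡ-∨ x (¬ d ∧ ¬ d′) (a′ ∧ ¬ d′)) ⟩
    ((x ∧ (¬ d ∧ ¬ d′)) ∨ (x ∧ (a′ ∧ ¬ d′))) ∨ (A ∨ a′)
      ≈⟨ ∨.interchange (x ∧ (¬ d ∧ ¬ d′)) (x ∧ (a′ ∧ ¬ d′)) A a′ ⟩
    ((x ∧ (¬ d ∧ ¬ d′)) ∨ A) ∨ ((x ∧ (a′ ∧ ¬ d′)) ∨ a′)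
      ≈⟨ ∨-congˡ absorbed ⟩
    ((x ∧ (¬ d ∧ ¬ d′)) ∨ A) ∨ a′
      ≈⟨ ∨-congʳ (∨-congʳ (∧-assoc x (¬ d) (¬ d′))) ⟨
    (((x ∧ ¬ d) ∧ ¬ d′) ∨ (a ∧ ¬ d′)) ∨ a′
      ≈⟨ ∨-congʳ (∧-distribʳ-∨ (¬ d′) (x ∧ ¬ d) a) ⟨
    (((x ∧ ¬ d) ∨ a) ∧ ¬ d′) ∨ a′ ∎)
    where
    A = a ∧ ¬ d′
    absorbed : (x ∧ (a′ ∧ ¬ d′)) ∨ a′ ≈ a′
    absorbed = begin
      (x ∧ (a′ ∧ ¬ d′)) ∨ a′  ≈⟨ ∨-congʳ (∧.x∙yz≈y∙xz x a′ (¬ d′)) ⟩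
      (a′ ∧ (x ∧ ¬ d′)) ∨ a′  ≈⟨ ∨-comm _ a′ ⟩
      a′ ∨ (a′ ∧ (x ∧ ¬ d′))  ≈⟨ ∨-absorbs-∧ a′ (x ∧ ¬ d′) ⟩
      a′                      ∎

  ⊕⋈≈patch : ∀ a {p q} → Disjoint (p , q) → a ⊕⋈ (p , q) ≈ patch a q p
  ⊕⋈≈patch a {p} {q} p∧q≈⊥ = begin
    (a ∨ p) ∧ ¬ q          ≈⟨ ∧-distribʳ-∨ (¬ q) a p ⟩
    (a ∧ ¬ q) ∨ (p ∧ ¬ q)  ≈⟨ ∨-congˡ (x∧y≈⊥⇒x∧¬y≈x p∧q≈⊥) ⟩
    (a ∧ ¬ q) ∨ p          ∎

  ⋈-disjoint : ∀ {p q r s} → Disjoint (p , q) → Disjoint (r , s) →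
               Disjoint ((p , q) ⋈ (r , s))
  ⋈-disjoint {p} {q} {r} {s} p∧q≈⊥ r∧s≈⊥ = begin
    ((p ∧ ¬ s) ∨ r) ∧ Y          ≈⟨ ∧-distribʳ-∨ Y (p ∧ ¬ s) r ⟩
    ((p ∧ ¬ s) ∧ Y) ∨ (r ∧ Y)    ≈⟨ ∨-cong kept added ⟩
    ⊥ ∨ ⊥                        ≈⟨ ∨-idem ⊥ ⟩
    ⊥                            ∎
    where
    Y = (q ∧ ¬ r) ∨ s
    kept : (p ∧ ¬ s) ∧ Y ≈ ⊥
    kept = begin
      (p ∧ ¬ s) ∧ ((q ∧ ¬ r) ∨ s)
        ≈⟨ ∧-distribˡ-∨ (p ∧ ¬ s) (q ∧ ¬ r) s ⟩
      ((p ∧ ¬ s) ∧ (q ∧ ¬ r)) ∨ ((p ∧ ¬ s) ∧ s)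
        ≈⟨ ∨-cong (∧.interchange p (¬ s) q (¬ r)) (∧-assoc p (¬ s) s) ⟩
      ((p ∧ q) ∧ (¬ s ∧ ¬ r)) ∨ (p ∧ (¬ s ∧ s))
        ≈⟨ ∨-cong (∧-congʳ p∧q≈⊥) (∧-congˡ (∧-complementˡ s)) ⟩
      (⊥ ∧ (¬ s ∧ ¬ r)) ∨ (p ∧ ⊥)
        ≈⟨ ∨-cong (∧-zeroˡ (¬ s ∧ ¬ r)) (∧-zeroʳ p) ⟩
      ⊥ ∨ ⊥
        ≈⟨ ∨-idem ⊥ ⟩
      ⊥ ∎
    added : r ∧ Y ≈ ⊥
    added = begin
      r ∧ ((q ∧ ¬ r) ∨ s)      ≈⟨ ∧-distribˡ-∨ r (q ∧ ¬ r) s ⟩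
      (r ∧ (q ∧ ¬ r)) ∨ (r ∧ s) ≈⟨ ∨-cong (∧.x∙yz≈y∙xz r q (¬ r)) r∧s≈⊥ ⟩
      (q ∧ (r ∧ ¬ r)) ∨ ⊥       ≈⟨ ∨-congʳ (∧-congˡ (∧-complementʳ r)) ⟩
      (q ∧ ⊥) ∨ ⊥               ≈⟨ ∨-congʳ (∧-zeroʳ q) ⟩
      ⊥ ∨ ⊥                     ≈⟨ ∨-idem ⊥ ⟩
      ⊥                         ∎

  ⊕⋈-⋈ : ∀ a {δ₁ δ₂} → Disjoint δ₁ → Disjoint δ₂ →
         a ⊕⋈ (δ₁ ⋈ δ₂) ≈ (a ⊕⋈ δ₁) ⊕⋈ δ₂
  ⊕⋈-⋈ a {p , q} {r , s} δ₁∈ δ₂∈ = begin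
    a ⊕⋈ ((p , q) ⋈ (r , s))               ≈⟨ ⊕⋈≈patch a (⋈-disjoint δ₁∈ δ₂∈) ⟩
    patch a (patch q r s) (patch p s r)    ≈⟨ patch-patch a q p s r ⟨
    patch (patch a q p) s r                ≈⟨ patch-cong (⊕⋈≈patch a δ₁∈) refl refl ⟨
    patch (a ⊕⋈ (p , q)) s r               ≈⟨ ⊕⋈≈patch (a ⊕⋈ (p , q)) δ₂∈ ⟨
    (a ⊕⋈ (p , q)) ⊕⋈ (r , s)              ∎

  isOrderedChangeAction⋈ : IsOrderedChangeAction⋈
  isOrderedChangeAction⋈ = record
    { ≈D-isEquivalence = ×-isEquivalence isEquivalence isEquivalence
    ; 0-closed = ∧-idem ⊥
    ; +-closed = ⋈-disjoint
    ; +-cong = λ _ _ _ _ (p≈ , q≈) (r≈ , s≈) →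
        patch-cong p≈ s≈ r≈ , patch-cong q≈ r≈ s≈
    ; +-assoc = λ {(p , q)} {(r , s)} {(t , u)} _ _ _ →
        patch-patch p s r u t , patch-patch q r s t u
    ; +-identityˡ = λ {(r , s)} _ → ⊥-patch s r , ⊥-patch r s
    ; +-identityʳ = λ {(p , q)} _ → patch-⊥-⊥ p , patch-⊥-⊥ q
    ; ≈A-isEquivalence = isEquivalence
    ; ⊕-cong = λ _ _ a≈ (p≈ , q≈) → ∧-cong (∨-cong a≈ p≈) (¬-cong q≈)
    ; ⊕-identity = λ a → trans (⊕⋈≈patch a (∧-idem ⊥)) (patch-⊥-⊥ a)
    ; ⊕-+ = ⊕⋈-⋈
    ; A-isPartialOrder = Lattice.isPartialOrder ∨-∧-orderTheoreticLattice
    ; ≤D-refl = λ _ _ → ⋈.reflexive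
    ; ≤D-trans = λ _ _ _ → ⋈.trans
    ; ≤D-antisym = λ _ _ → ⋈.antisym
    ; ⊕-mono = λ _ _ a≤ (p≤ , q≥) → ∧-monotonic (∨-monotonic a≤ p≤) (¬-antitone q≥)
    ; +-mono = λ _ _ _ _ (p≤ , q≥) (r≤ , s≥) →
        patch-mono p≤ s≥ r≤ , patch-mono q≥ r≤ s≥
    }

mainTheorem8 : {c ℓ : Level} (L : BooleanAlgebra c ℓ) →
    BowtieChange.IsOrderedChangeAction⋈ L
mainTheorem8 = isOrderedChangeAction⋈
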